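{- For a positive integer $n$, the group $(\mathbb{Z}/n\mathbb{Z})^\times$ is maximally non-cyclic if and only if (a) $2^4\nmid n$; (b) $p^3\nmid n$ for every odd prime $p$; and (c) $p-1$ is squarefree for every prime $p\mid n$.
   Context: A finite abelian group is maximally non-cyclic if for every prime $p$ its Sylow $p$-subgroup is an elementary abelian $p$-group, i.e. of the form $\mathbb{Z}/p\mathbb{Z}\times\cdots\times\mathbb{Z}/p\mathbb{Z}$ (equivalently, every factor in its primary decomposition is $\mathbb{Z}/p\mathbb{Z}$ for some prime $p$). -}

module Defs where

open import Data.Nat using (ℕ; NonZero; _^_; _<_; _%_; _*_)
open import Data.Nat.Divisibility using (_∣_)
open import Data.Nat.Coprimality using (Coprime)
open import Data.Nat.Primality using (Prime)
open import Data.Product using (Σ; ∃; _×_)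
open import Relation.Binary.PropositionalEquality using (_≡_)

-- The unit group (ℤ/nℤ)ˣ, for n ≥ 1: residues a with a < n and gcd(a,n) = 1,
-- with multiplication modulo n; the identity is the class of 1 (= 1 % n).
IsUnitMod : (n : ℕ) → .⦃ NonZero n ⦄ → ℕ → Set
IsUnitMod n a = (a < n) × Coprime a n

PowIsOne : (n : ℕ) → .⦃ NonZero n ⦄ → ℕ → ℕ → Set
PowIsOne n g k = (g ^ k) % n ≡ 1 % n

InSylow : (n : ℕ) → .⦃ NonZero n ⦄ → ℕ → ℕ → Set
InSylow n p g = IsUnitMod n g × ∃ λ k → PowIsOne n g (p ^ k)

SylowElementaryAbelian : (n : ℕ) → .⦃ NonZero n ⦄ → ℕ → Set
SylowElementaryAbelian n p = ∀ g → InSylow n p g → PowIsOne n g p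

UnitsMaximallyNonCyclic : (n : ℕ) → .⦃ NonZero n ⦄ → Set
UnitsMaximallyNonCyclic n = ∀ p → Prime p → SylowElementaryAbelian n p

SquareFree : ℕ → Set
SquareFree m = ∀ d → d * d ∣ m → d ≡ 1

-- (ℤ/nℤ)ˣ is maximally non-cyclic exactly when no unit has order q² for a prime q.
-- If 2⁴ ∣ n, then 1 + n/4 has order 4; if p³ ∣ n with p odd, then 1 + n/p² has order p².
-- If q² ∣ p - 1 for a prime p ∣ n, then X^((p-1)/q) - 1 cannot vanish at all p - 1 units
-- modulo p, so some unit modulo p has order divisible by q²; a power of it, lifted to p^a by
-- raising to p^(a-1) and glued with 1 modulo n/p^a by the Chinese remainder theorem, has
-- order q² modulo n.
-- Conversely, under the three conditions every unit g satisfies g² ≡ 1 modulo the 2-part of n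
-- (which divides 8) and g^((p-1)p) ≡ 1 modulo the p-part for odd p (which divides p²), by
-- Fermat and lifting the exponent; as q² divides neither exponent, g^(q^k) ≡ 1 forces g^q ≡ 1.
module Submission where

open import Defs

module PrimeDivisibility where

  open import Data.Empty using (⊥-elim)
  open import Data.List using ([]; _∷_)
  open import Data.List.Relation.Unary.All using (_∷_)
  open import Data.Nat using (zero; suc; _+_; _*_; _^_; _∸_; _%_; _/_; _<_; _≤_; z≤n; s≤s; _≤?_; NonZero; ≢-nonZero; ≢-nonZero⁻¹; nonTrivial⇒n>1)
  open import Data.Nat.DivMod using (m≡m%n+[m/n]*n; m%n<n)
  open import Data.Nat.Coprimality using (Coprime; coprime-divisor)
  open import Data.Nat.Divisibility using (_∣_; divides; _∣?_; ∣-trans; ∣1⇒≡1; 1∣_; m∣m*n; m%n≡0⇒n∣m)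
  open import Data.Nat.Induction using (<-wellFounded)
  open import Data.Nat.ListAction using (product)
  open import Data.Nat.Primality using (Prime; ¬prime[1]; prime⇒irreducible; prime⇒nonTrivial; prime⇒nonZero)
  open import Data.Nat.Primality.Factorisation using (factorise)
  open import Data.Nat.Properties
  open import Data.Nat.Tactic.RingSolver using (solve-∀)
  open import Data.Product using (∃; ∃₂; _×_; _,_)
  open import Data.Sum using (inj₁; inj₂)
  open import Induction.WellFounded using (Acc; acc)
  open import Relation.Binary.PropositionalEquality using (_≡_; _≢_; refl; sym; trans; cong; cong₂; subst)
  open import Relation.Nullary using (¬_; yes; no)

  prime>1 : ∀ {p} → Prime p → 1 < p
  prime>1 {p} p-prime = nonTrivial⇒n>1 p ⦃ prime⇒nonTrivial p-prime ⦄

  odd-prime : ∀ {p} → Prime p → p ≢ 2 → ∃ λ h → p ≡ 1 + 2 * h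
  odd-prime {p} p-prime p≢2 with p % 2 in p%2≡ | m%n<n p 2
  ... | 0           | _ with prime⇒irreducible p-prime (m%n≡0⇒n∣m p 2 p%2≡)
  ...   | inj₂ 2≡p = ⊥-elim (p≢2 (sym 2≡p))
  odd-prime {p} p-prime p≢2 | 1 | _ =
    p / 2 , trans (m≡m%n+[m/n]*n p 2) (trans (cong (_+ p / 2 * 2) p%2≡) (cong suc (*-comm (p / 2) 2)))
  odd-prime {p} p-prime p≢2 | suc (suc _) | s≤s (s≤s ())

  ∣[p∸1]⇒p^j≡1+cq : ∀ {p q} .⦃ _ : NonZero p ⦄ → q ∣ p ∸ 1 → ∀ j → ∃ λ c → p ^ j ≡ 1 + c * q
  ∣[p∸1]⇒p^j≡1+cq {suc p-1} q∣p-1 zero = 0 , refl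
  ∣[p∸1]⇒p^j≡1+cq {suc p-1} {q} q∣p-1@(divides b p-1≡bq) (suc j) with ∣[p∸1]⇒p^j≡1+cq q∣p-1 j
  ... | c , p^j≡1+cq = b + c * (1 + b * q) , trans (cong₂ _*_ (cong suc p-1≡bq) p^j≡1+cq) (expand b c q)
    where
    expand : ∀ b c q → (1 + b * q) * (1 + c * q) ≡ 1 + (b + c * (1 + b * q)) * q
    expand = solve-∀

  prime∤1 : ∀ {p} → Prime p → ¬ p ∣ 1
  prime∤1 p-prime p∣1 = ¬prime[1] (subst Prime (∣1⇒≡1 p∣1) p-prime)

  ∤⇒coprime : ∀ {p d} → Prime p → ¬ p ∣ d → Coprime d p
  ∤⇒coprime p-prime p∤d (i∣d , i∣p) with prime⇒irreducible p-prime i∣p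
  ... | inj₁ i≡1   = i≡1
  ... | inj₂ refl  = ⊥-elim (p∤d i∣d)

  ∣p^k∧p∤⇒≡1 : ∀ {p d} → Prime p → ¬ p ∣ d → ∀ k → d ∣ p ^ k → d ≡ 1
  ∣p^k∧p∤⇒≡1 p-prime p∤d zero    d∣1      = ∣1⇒≡1 d∣1
  ∣p^k∧p∤⇒≡1 p-prime p∤d (suc k) d∣p^1+k = ∣p^k∧p∤⇒≡1 p-prime p∤d k (coprime-divisor (∤⇒coprime p-prime p∤d) d∣p^1+k)

  coprime-^ : ∀ {p m} → Prime p → ¬ p ∣ m → ∀ a → Coprime (p ^ a) m
  coprime-^ p-prime p∤m a (i∣p^a , i∣m) = ∣p^k∧p∤⇒≡1 p-prime (λ p∣i → p∤m (∣-trans p∣i i∣m)) a i∣p^a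

  coprime⇒*∣ : ∀ {a b n} → Coprime a b → a ∣ n → b ∣ n → a * b ∣ n
  coprime⇒*∣ {a} {b} coprime a∣n (divides u refl) with coprime-divisor coprime (subst (a ∣_) (*-comm u b) a∣n)
  ... | divides v refl = divides v (*-assoc v a b)

  ∣p^k∧p²∤⇒∣p : ∀ {p d} → Prime p → ∀ k → d ∣ p ^ k → ¬ p * p ∣ d → d ∣ p
  ∣p^k∧p²∤⇒∣p {p} {d} p-prime k d∣p^k p²∤d with p ∣? d
  ... | no p∤d = subst (_∣ p) (sym (∣p^k∧p∤⇒≡1 p-prime p∤d k d∣p^k)) (1∣ p)
  ... | yes (divides e refl) with p ∣? e
  ...   | yes (divides f refl) = ⊥-elim (p²∤d (divides f (*-assoc f p p)))
  ...   | no p∤e with ∣p^k∧p∤⇒≡1 p-prime p∤e k (∣-trans (m∣m*n p) d∣p^k)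
  ...     | refl = divides 1 (sym (trans (*-identityˡ (1 * p)) (*-identityˡ p)))

  ^-monoʳ-∣ : ∀ p {a b} → a ≤ b → p ^ a ∣ p ^ b
  ^-monoʳ-∣ p {a} {b} a≤b =
    divides (p ^ (b ∸ a)) (trans (cong (p ^_) (sym (m+[n∸m]≡n a≤b))) (trans (^-distribˡ-+-* p a (b ∸ a)) (*-comm (p ^ a) _)))

  p^a∣n∧p^[1+b]∤n⇒p^a∣p^b : ∀ p {n} a b → p ^ a ∣ n → ¬ p ^ suc b ∣ n → p ^ a ∣ p ^ b
  p^a∣n∧p^[1+b]∤n⇒p^a∣p^b p a b p^a∣n p^[1+b]∤n with a ≤? b
  ... | yes a≤b = ^-monoʳ-∣ p a≤b
  ... | no  a≰b = ⊥-elim (p^[1+b]∤n (∣-trans (^-monoʳ-∣ p (≰⇒> a≰b)) p^a∣n))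

  prime-factor : ∀ n → 1 < n → ∃ λ p → Prime p × p ∣ n
  prime-factor 1              (s≤s ())
  prime-factor n@(suc (suc _)) _ with factorise n
  ... | record { factors = []     ; isFactorisation = () }
  ... | record { factors = p ∷ ps ; isFactorisation = n≡p*ps ; factorsPrime = p-prime ∷ _ } =
    p , p-prime , divides (product ps) (trans n≡p*ps (*-comm p (product ps)))

  nonZero-factor : ∀ {n} c d .⦃ _ : NonZero n ⦄ → n ≡ c * d → NonZero c
  nonZero-factor {n} c d n≡cd = ≢-nonZero (λ c≡0 → ≢-nonZero⁻¹ n (trans n≡cd (cong (_* d) c≡0)))

  p-part : ∀ {p} → Prime p → ∀ n .⦃ _ : NonZero n ⦄ → ∃₂ λ a m → n ≡ p ^ a * m × ¬ p ∣ m
  p-part {p} p-prime n = go n (<-wellFounded n)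
    where
    go : ∀ n .⦃ _ : NonZero n ⦄ → Acc _<_ n → ∃₂ λ a m → n ≡ p ^ a * m × ¬ p ∣ m
    go n (acc rec) with p ∣? n
    ... | no p∤n = 0 , n , sym (+-identityʳ n) , p∤n
    ... | yes (divides c n≡cp) with go c ⦃ nonZero-factor c p n≡cp ⦄ (rec c<n)
      where
      c<n : c < n
      c<n = subst (c <_) (sym n≡cp) (m<m*n c p ⦃ nonZero-factor c p n≡cp ⦄ (prime>1 p-prime))
    ...   | a , m , c≡p^am , p∤m = suc a , m , trans n≡cp (trans (cong (_* p) c≡p^am) (rotate (p ^ a) m p)) , p∤m
      where
      rotate : ∀ x m p → x * m * p ≡ p * x * m
      rotate = solve-∀

  p-part⁺ : ∀ {p n} .⦃ _ : NonZero n ⦄ → Prime p → p ∣ n → ∃₂ λ a m → n ≡ p ^ suc a * m × ¬ p ∣ m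
  p-part⁺ {p} {n} p-prime p∣n with p-part p-prime n
  ... | zero  , m , n≡m , p∤m         = ⊥-elim (p∤m (subst (p ∣_) (trans n≡m (+-identityʳ m)) p∣n))
  ... | suc a , m , n≡p^[1+a]m , p∤m = a , m , n≡p^[1+a]m , p∤m

  prime-powers∣⇒∣ : ∀ n .⦃ _ : NonZero n ⦄ {x} → (∀ p a → Prime p → p ^ a ∣ n → p ^ a ∣ x) → n ∣ x
  prime-powers∣⇒∣ n {x} = go n (<-wellFounded n)
    where
    go : ∀ n .⦃ _ : NonZero n ⦄ → Acc _<_ n → (∀ p a → Prime p → p ^ a ∣ n → p ^ a ∣ x) → n ∣ x
    go 1                (acc rec) _          = 1∣ x
    go n@(suc (suc _)) (acc rec) prime-powers with prime-factor n (s≤s (s≤s z≤n))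
    ... | p , p-prime , p∣n with p-part⁺ p-prime p∣n
    ...   | a , m , n≡p^[1+a]m , p∤m =
      subst (_∣ x) (sym n≡p^[1+a]m)
        (coprime⇒*∣ (coprime-^ p-prime p∤m (suc a))
          (prime-powers p (suc a) p-prime (divides m (trans n≡p^[1+a]m (*-comm (p ^ suc a) m))))
          (go m ⦃ m≢0 ⦄ (rec m<n) (λ q b q-prime q^b∣m → prime-powers q b q-prime (∣-trans q^b∣m m∣n))))
      where
      m∣n : m ∣ n
      m∣n = divides (p ^ suc a) n≡p^[1+a]m
      m≢0 : NonZero m
      m≢0 = nonZero-factor m (p ^ suc a) (trans n≡p^[1+a]m (*-comm (p ^ suc a) m))
      1<p^[1+a] : 1 < p ^ suc a
      1<p^[1+a] = <-≤-trans (prime>1 p-prime) (m≤m*n p (p ^ a) ⦃ m^n≢0 p a ⦃ prime⇒nonZero p-prime ⦄ ⦄)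
      m<n : m < n
      m<n = subst (m <_) (trans (*-comm m _) (sym n≡p^[1+a]m)) (m<m*n m (p ^ suc a) ⦃ m≢0 ⦄ 1<p^[1+a])

module Congruence where

  open import Data.Integer using (ℤ; 0ℤ; _+_; _-_; -_; _*_; _^_)
  open import Data.Integer.Divisibility.Signed using (_∣_; divides; ∣-refl; ∣-trans; ∣m∣n⇒∣m+n; ∣m⇒∣m*n; ∣n⇒∣m*n; ∣m⇒∣-m)
  import Data.Integer.Properties as ℤ
  open import Data.Integer.Tactic.RingSolver using (solve-∀)
  open import Data.Nat using (zero; suc)
  open import Level using (0ℓ)
  open import Relation.Binary.Bundles using (Setoid)
  open import Relation.Binary.PropositionalEquality using (_≡_; refl; sym; trans; subst)
  import Relation.Binary.Reasoning.Setoid as SetoidReasoning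

  infix 4 _≡_[mod_]
  record _≡_[mod_] (x y m : ℤ) : Set where
    constructor ≡mod
    field m∣x-y : m ∣ x - y

  open _≡_[mod_] public

  mod-refl : ∀ {x m} → x ≡ x [mod m ]
  mod-refl {x} {m} = ≡mod (divides 0ℤ (trans (ℤ.+-inverseʳ x) (sym (ℤ.*-zeroˡ m))))

  mod-reflexive : ∀ {x y m} → x ≡ y → x ≡ y [mod m ]
  mod-reflexive refl = mod-refl

  mod-sym : ∀ {x y m} → x ≡ y [mod m ] → y ≡ x [mod m ]
  mod-sym {x} {y} (≡mod m∣x-y) = ≡mod (subst (_ ∣_) (neg-diff x y) (∣m⇒∣-m m∣x-y))
    where
    neg-diff : ∀ x y → - (x - y) ≡ y - x
    neg-diff = solve-∀

  mod-trans : ∀ {x y z m} → x ≡ y [mod m ] → y ≡ z [mod m ] → x ≡ z [mod m ]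
  mod-trans {x} {y} {z} (≡mod m∣x-y) (≡mod m∣y-z) =
    ≡mod (subst (_ ∣_) (telescope x y z) (∣m∣n⇒∣m+n m∣x-y m∣y-z))
    where
    telescope : ∀ x y z → (x - y) + (y - z) ≡ x - z
    telescope = solve-∀

  mod-setoid : ℤ → Setoid 0ℓ 0ℓ
  mod-setoid m = record
    { Carrier       = ℤ
    ; _≈_           = λ x y → x ≡ y [mod m ]
    ; isEquivalence = record { refl = mod-refl ; sym = mod-sym ; trans = mod-trans }
    }

  module ≡-mod-Reasoning (m : ℤ) = SetoidReasoning (mod-setoid m)

  +-cong-mod : ∀ {x y u v m} → x ≡ y [mod m ] → u ≡ v [mod m ] → x + u ≡ y + v [mod m ]
  +-cong-mod {x} {y} {u} {v} (≡mod m∣x-y) (≡mod m∣u-v) =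
    ≡mod (subst (_ ∣_) (regroup x y u v) (∣m∣n⇒∣m+n m∣x-y m∣u-v))
    where
    regroup : ∀ x y u v → (x - y) + (u - v) ≡ (x + u) - (y + v)
    regroup = solve-∀

  *-cong-mod : ∀ {x y u v m} → x ≡ y [mod m ] → u ≡ v [mod m ] → x * u ≡ y * v [mod m ]
  *-cong-mod {x} {y} {u} {v} (≡mod m∣x-y) (≡mod m∣u-v) =
    ≡mod (subst (_ ∣_) (regroup x y u v) (∣m∣n⇒∣m+n (∣m⇒∣m*n u m∣x-y) (∣n⇒∣m*n y m∣u-v)))
    where
    regroup : ∀ x y u v → (x - y) * u + y * (u - v) ≡ x * u - y * v
    regroup = solve-∀

  ^-cong-mod : ∀ {x y m} k → x ≡ y [mod m ] → x ^ k ≡ y ^ k [mod m ]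
  ^-cong-mod zero    x≡y = mod-refl
  ^-cong-mod (suc k) x≡y = *-cong-mod x≡y (^-cong-mod k x≡y)

  ∣⇒x+y≡x : ∀ {m} x {y} → m ∣ y → x + y ≡ x [mod m ]
  ∣⇒x+y≡x x {y} m∣y = ≡mod (subst (_ ∣_) (sym (cancel x y)) m∣y)
    where
    cancel : ∀ x y → (x + y) - x ≡ y
    cancel = solve-∀

  x+m≡x : ∀ x m → x + m ≡ x [mod m ]
  x+m≡x x m = ∣⇒x+y≡x x ∣-refl

  x+km≡x : ∀ x k m → x + k * m ≡ x [mod m ]
  x+km≡x x k m = ∣⇒x+y≡x x (∣n⇒∣m*n k ∣-refl)

  mod-∣ : ∀ {x y m n} → m ∣ n → x ≡ y [mod n ] → x ≡ y [mod m ]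
  mod-∣ m∣n (≡mod n∣x-y) = ≡mod (∣-trans m∣n n∣x-y)

  subst-modulus : ∀ {x y m n} → m ≡ n → x ≡ y [mod m ] → x ≡ y [mod n ]
  subst-modulus refl x≡y = x≡y

  ≡mod⇒-≡0 : ∀ {x y m} → x ≡ y [mod m ] → x - y ≡ 0ℤ [mod m ]
  ≡mod⇒-≡0 {x} {y} (≡mod m∣x-y) = ≡mod (subst (_ ∣_) (sym (ℤ.+-identityʳ (x - y))) m∣x-y)

  -≡0⇒≡mod : ∀ {x y m} → x - y ≡ 0ℤ [mod m ] → x ≡ y [mod m ]
  -≡0⇒≡mod {x} {y} (≡mod m∣x-y-0) = ≡mod (subst (_ ∣_) (ℤ.+-identityʳ (x - y)) m∣x-y-0)


module Residues where

  open Congruence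
  open import Data.Integer using (+_; -[1+_]; 0ℤ; 1ℤ; _+_; _-_; -_; _*_; _^_; ∣_∣)
  open import Data.Integer.Divisibility.Signed using (_∣_; divides; ∣⇒∣ᵤ; ∣ᵤ⇒∣)
  import Data.Integer.Properties as ℤ
  open import Data.Integer.Tactic.RingSolver using (solve-∀)
  open import Data.Nat as ℕ using (zero; suc; NonZero; _%_; _/_)
  import Data.Nat.Divisibility as ℕ
  open import Data.Nat.DivMod using (m≡m%n+[m/n]*n; [m+kn]%n≡m%n)
  open import Data.Nat.Primality using (Prime; euclidsLemma)
  import Data.Nat.Properties as ℕ
  open import Data.Sum using (_⊎_; inj₁; inj₂)
  open import Relation.Binary.PropositionalEquality using (_≡_; refl; sym; trans; cong; subst)
  open import Relation.Nullary using (¬_)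

  pos-^ : ∀ a k → + (a ℕ.^ k) ≡ (+ a) ^ k
  pos-^ a zero    = refl
  pos-^ a (suc k) = trans (ℤ.pos-* a (a ℕ.^ k)) (cong (+ a *_) (pos-^ a k))

  pos-+* : ∀ a k n → + (a ℕ.+ k ℕ.* n) ≡ + a + + k * + n
  pos-+* a k n = trans (ℤ.pos-+ a (k ℕ.* n)) (cong (λ z → + a + z) (ℤ.pos-* k n))

  ∣∣⇒≡0-mod : ∀ {M x} → M ℕ.∣ ∣ x ∣ → x ≡ 0ℤ [mod + M ]
  ∣∣⇒≡0-mod {M} {x} M∣x = ≡mod (subst (+ M ∣_) (sym (ℤ.+-identityʳ x)) (∣ᵤ⇒∣ M∣x))

  ≡0-mod⇒∣∣ : ∀ {M x} → x ≡ 0ℤ [mod + M ] → M ℕ.∣ ∣ x ∣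
  ≡0-mod⇒∣∣ {M} {x} (≡mod M∣x-0) = ∣⇒∣ᵤ (subst (+ M ∣_) (ℤ.+-identityʳ x) M∣x-0)

  residue-mod : ∀ n .⦃ _ : NonZero n ⦄ a → + a ≡ + (a % n) [mod + n ]
  residue-mod n a = begin
    + a                             ≡⟨ cong +_ (m≡m%n+[m/n]*n a n) ⟩
    + (a % n ℕ.+ a / n ℕ.* n)       ≡⟨ pos-+* (a % n) (a / n) n ⟩
    + (a % n) + + (a / n) * + n     ≈⟨ x+km≡x (+ (a % n)) (+ (a / n)) (+ n) ⟩
    + (a % n)                       ∎
    where open ≡-mod-Reasoning (+ n)

  %≡%⇒≡mod : ∀ n .⦃ _ : NonZero n ⦄ a b → a % n ≡ b % n → + a ≡ + b [mod + n ]
  %≡%⇒≡mod n a b eq =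
    mod-trans (residue-mod n a) (mod-trans (mod-reflexive (cong +_ eq)) (mod-sym (residue-mod n b)))

  a-b≡kn⇒%≡% : ∀ n .⦃ _ : NonZero n ⦄ {a b} k → + a - + b ≡ + k * + n → a % n ≡ b % n
  a-b≡kn⇒%≡% n {a} {b} k a-b≡kn = trans (cong (_% n) a≡b+kn) ([m+kn]%n≡m%n b k n)
    where
    split : ∀ x y → x ≡ y + (x - y)
    split = solve-∀
    a≡b+kn : a ≡ b ℕ.+ k ℕ.* n
    a≡b+kn = ℤ.+-injective (trans (split (+ a) (+ b)) (trans (cong (λ z → + b + z) a-b≡kn) (sym (pos-+* b k n))))

  ≡mod⇒%≡% : ∀ n .⦃ _ : NonZero n ⦄ a b → + a ≡ + b [mod + n ] → a % n ≡ b % n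
  ≡mod⇒%≡% n a b (≡mod (divides (+ k)     a-b≡kn)) = a-b≡kn⇒%≡% n k a-b≡kn
  ≡mod⇒%≡% n a b (≡mod (divides -[1+ k ] a-b≡kn)) = sym (a-b≡kn⇒%≡% n (suc k) b-a≡[1+k]n)
    where
    neg-diff : ∀ x y → y - x ≡ - (x - y)
    neg-diff = solve-∀
    b-a≡[1+k]n : + b - + a ≡ + suc k * + n
    b-a≡[1+k]n = trans (neg-diff (+ a) (+ b)) (trans (cong -_ a-b≡kn) (ℤ.neg-distribˡ-* -[1+ k ] (+ n)))

  1+a≢1-mod : ∀ {a M} → 0 ℕ.< a → a ℕ.< M → ¬ (1ℤ + + a ≡ 1ℤ [mod + M ])
  1+a≢1-mod {a} {M} 0<a a<M 1+a≡1 =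
    ℕ.<⇒≱ a<M (ℕ.∣⇒≤ ⦃ ℕ.>-nonZero 0<a ⦄ (≡0-mod⇒∣∣ (subst (_≡ 0ℤ [mod + M ]) (cancel (+ a)) (≡mod⇒-≡0 1+a≡1))))
    where
    cancel : ∀ x → (1ℤ + x) - 1ℤ ≡ x
    cancel = solve-∀

  euclid-mod : ∀ {p} → Prime p → ∀ x y → x * y ≡ 0ℤ [mod + p ] → x ≡ 0ℤ [mod + p ] ⊎ y ≡ 0ℤ [mod + p ]
  euclid-mod {p} p-prime x y xy≡0
    with euclidsLemma ∣ x ∣ ∣ y ∣ p-prime (subst (p ℕ.∣_) (ℤ.∣i*j∣≡∣i∣*∣j∣ x y) (≡0-mod⇒∣∣ xy≡0))
  ... | inj₁ p∣x = inj₁ (∣∣⇒≡0-mod p∣x)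
  ... | inj₂ p∣y = inj₂ (∣∣⇒≡0-mod p∣y)


module PowersModulo where

  open Congruence
  open import Data.Integer using (1ℤ; _*_; _^_)
  import Data.Integer.Properties as ℤ
  import Data.Nat as ℕ
  import Data.Nat.Divisibility as ℕ
  open import Data.Nat.GCD using (gcd; gcd-GCD; module Bézout)
  import Data.Nat.Properties as ℕ
  open import Relation.Binary.PropositionalEquality using (_≡_; refl; sym; cong; subst)

  ^≡1⇒^*≡1 : ∀ {x m} a c → x ^ a ≡ 1ℤ [mod m ] → x ^ (c ℕ.* a) ≡ 1ℤ [mod m ]
  ^≡1⇒^*≡1 {x} {m} a c x^a≡1 = begin
    x ^ (c ℕ.* a)  ≡⟨ cong (x ^_) (ℕ.*-comm c a) ⟩
    x ^ (a ℕ.* c)  ≡⟨ ℤ.^-*-assoc x a c ⟨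
    (x ^ a) ^ c    ≈⟨ ^-cong-mod c x^a≡1 ⟩
    1ℤ ^ c         ≡⟨ ℤ.^-zeroˡ c ⟩
    1ℤ             ∎
    where open ≡-mod-Reasoning m

  ^≡1-∣ : ∀ {x m a b} → a ℕ.∣ b → x ^ a ≡ 1ℤ [mod m ] → x ^ b ≡ 1ℤ [mod m ]
  ^≡1-∣ {a = a} (ℕ.divides c refl) = ^≡1⇒^*≡1 a c

  ^≡1-cancel : ∀ {x m} a b → x ^ b ≡ 1ℤ [mod m ] → x ^ (a ℕ.+ b) ≡ 1ℤ [mod m ] → x ^ a ≡ 1ℤ [mod m ]
  ^≡1-cancel {x} {m} a b x^b≡1 x^a+b≡1 = begin
    x ^ a          ≡⟨ ℤ.*-identityʳ (x ^ a) ⟨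
    x ^ a * 1ℤ     ≈⟨ *-cong-mod (mod-refl {x ^ a}) (mod-sym x^b≡1) ⟩
    x ^ a * x ^ b  ≡⟨ ℤ.^-distribˡ-+-* x a b ⟨
    x ^ (a ℕ.+ b)  ≈⟨ x^a+b≡1 ⟩
    1ℤ             ∎
    where open ≡-mod-Reasoning m

  ^≡1-gcd : ∀ {x m} a b → x ^ a ≡ 1ℤ [mod m ] → x ^ b ≡ 1ℤ [mod m ] → x ^ gcd a b ≡ 1ℤ [mod m ]
  ^≡1-gcd {x} {m} a b x^a≡1 x^b≡1 with Bézout.identity (gcd-GCD a b)
  ... | Bézout.+- u v eq = ^≡1-cancel (gcd a b) (v ℕ.* b) (^≡1⇒^*≡1 b v x^b≡1)
                             (subst (λ k → x ^ k ≡ 1ℤ [mod m ]) (sym eq) (^≡1⇒^*≡1 a u x^a≡1))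
  ... | Bézout.-+ u v eq = ^≡1-cancel (gcd a b) (u ℕ.* a) (^≡1⇒^*≡1 a u x^a≡1)
                             (subst (λ k → x ^ k ≡ 1ℤ [mod m ]) (sym eq) (^≡1⇒^*≡1 b v x^b≡1))


module Lifting where

  open Congruence
  open import Data.Integer using (ℤ; +_; 0ℤ; 1ℤ; _+_; _-_; _*_; _^_)
  open import Data.Integer.Divisibility.Signed using (_∣_; divides)
  import Data.Integer.Properties as ℤ
  open import Data.Integer.Tactic.RingSolver using (solve-∀)
  open import Data.Nat as ℕ using (ℕ; zero; suc)
  import Data.Nat.Properties as ℕ
  open import Relation.Binary.PropositionalEquality using (_≡_; refl; sym; trans; cong; cong₂; subst₂; module ≡-Reasoning)

  geometric : ℤ → ℕ → ℤ
  geometric x zero    = 0ℤ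
  geometric x (suc n) = 1ℤ + x * geometric x n

  x^n-1≡[x-1]*geometric : ∀ x n → x ^ n - 1ℤ ≡ (x - 1ℤ) * geometric x n
  x^n-1≡[x-1]*geometric x zero    = sym (ℤ.*-zeroʳ (x - 1ℤ))
  x^n-1≡[x-1]*geometric x (suc n) = begin
    x * x ^ n - 1ℤ                           ≡⟨ step x (x ^ n) ⟩
    (x - 1ℤ) * 1ℤ + x * (x ^ n - 1ℤ)          ≡⟨ cong (λ y → (x - 1ℤ) * 1ℤ + x * y) (x^n-1≡[x-1]*geometric x n) ⟩
    (x - 1ℤ) * 1ℤ + x * ((x - 1ℤ) * geometric x n) ≡⟨ step′ x (geometric x n) ⟩
    (x - 1ℤ) * (1ℤ + x * geometric x n)      ∎
    where
    open ≡-Reasoning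
    step : ∀ x y → x * y - 1ℤ ≡ (x - 1ℤ) * 1ℤ + x * (y - 1ℤ)
    step = solve-∀
    step′ : ∀ x g → (x - 1ℤ) * 1ℤ + x * ((x - 1ℤ) * g) ≡ (x - 1ℤ) * (1ℤ + x * g)
    step′ = solve-∀

  geometric-≡-mod : ∀ {x m} n → x ≡ 1ℤ [mod m ] → geometric x n ≡ + n [mod m ]
  geometric-≡-mod zero    x≡1 = mod-refl
  geometric-≡-mod {x} {m} (suc n) x≡1 = begin
    1ℤ + x * geometric x n  ≈⟨ +-cong-mod (mod-refl {1ℤ}) (*-cong-mod x≡1 (geometric-≡-mod n x≡1)) ⟩
    1ℤ + 1ℤ * + n           ≡⟨ cong (_+_ 1ℤ) (ℤ.*-identityˡ (+ n)) ⟩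
    1ℤ + + n                ∎
    where open ≡-mod-Reasoning m

  -- x ≡ 1 mod c p makes 1 + x + ⋯ + x^(p-1) ≡ p ≡ 0 mod p, so x^p - 1 gains a factor p.
  ^p-lift : ∀ {x} c p → x ≡ 1ℤ [mod c * + p ] → x ^ p ≡ 1ℤ [mod c * + p * + p ]
  ^p-lift {x} c p x≡1@(≡mod (divides s x-1≡sc)) = ≡mod (divides (s * t) (begin
    x ^ p - 1ℤ              ≡⟨ x^n-1≡[x-1]*geometric x p ⟩
    (x - 1ℤ) * geometric x p ≡⟨ cong₂ _*_ x-1≡sc (trans (sym (ℤ.+-identityʳ (geometric x p))) g≡tp) ⟩
    s * (c * + p) * (t * + p) ≡⟨ regroup s c (+ p) t ⟩
    s * t * (c * + p * + p) ∎))
    where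
    open ≡-Reasoning
    g≡0 : geometric x p ≡ 0ℤ [mod + p ]
    g≡0 = mod-trans (geometric-≡-mod p (mod-∣ (divides c refl) x≡1))
                    (≡mod (divides 1ℤ (trans (ℤ.+-identityʳ (+ p)) (sym (ℤ.*-identityˡ (+ p))))))
    t : ℤ
    t = _∣_.quotient (m∣x-y g≡0)
    g≡tp : geometric x p - 0ℤ ≡ t * + p
    g≡tp = _∣_.equality (m∣x-y g≡0)
    regroup : ∀ s c p t → s * (c * p) * (t * p) ≡ s * t * (c * p * p)
    regroup = solve-∀

  ^p^j-lift : ∀ {x} c p j → x ≡ 1ℤ [mod c * + p ] → x ^ (p ℕ.^ j) ≡ 1ℤ [mod c * (+ p) ^ suc j ]
  ^p^j-lift {x} c p zero x≡1 =
    subst₂ (λ y m → y ≡ 1ℤ [mod m ]) (sym (ℤ.*-identityʳ x)) (cong (c *_) (sym (ℤ.*-identityʳ (+ p)))) x≡1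
  ^p^j-lift {x} c p (suc j) x≡1 =
    subst₂ (λ y m → y ≡ 1ℤ [mod m ])
      (trans (ℤ.^-*-assoc x (p ℕ.^ j) p) (cong (x ^_) (ℕ.*-comm (p ℕ.^ j) p)))
      (reassoc₂ c (+ p) ((+ p) ^ j))
      (^p-lift (c * (+ p) ^ j) p (subst-modulus (reassoc₁ c (+ p) ((+ p) ^ j)) (^p^j-lift c p j x≡1)))
    where
    reassoc₁ : ∀ c p q → c * (p * q) ≡ c * q * p
    reassoc₁ = solve-∀
    reassoc₂ : ∀ c p q → c * q * p * p ≡ c * (p * (p * q))
    reassoc₂ = solve-∀


module BinomialCoefficients where

  open import Data.Empty using (⊥-elim)
  open import Data.Nat using (ℕ; zero; suc; _+_; _*_; _^_; _<_; z≤n; s≤s)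
  open import Data.Nat.Combinatorics using (_C_; nCn≡1; nC1≡n; k>n⇒nCk≡0; nCk≡nC[n∸k]; nCk+nC[k+1]≡[n+1]C[k+1])
  open import Data.Nat.Divisibility using (_∣_; divides; _∣0; ∣m∣n⇒∣m+n; ∣-trans; m∣m*n; ∣⇒≤)
  open import Data.Nat.Primality using (Prime; euclidsLemma)
  open import Data.Nat.Properties
  open import Data.Nat.Tactic.RingSolver using (solve-∀)
  open import Data.Product using (∃; _,_)
  open import Data.Sum using (inj₁; inj₂)
  open import Function using (_∘_)
  open import Relation.Binary.PropositionalEquality using (_≡_; refl; sym; trans; cong; cong₂; module ≡-Reasoning)

  nC0≡1 : ∀ n → n C 0 ≡ 1
  nC0≡1 n = trans (nCk≡nC[n∸k] (z≤n {n})) (nCn≡1 n)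

  [1+k]*[1+n]C[1+k]≡[1+n]*nCk : ∀ n k → suc k * (suc n C suc k) ≡ suc n * (n C k)
  [1+k]*[1+n]C[1+k]≡[1+n]*nCk zero    zero    = refl
  [1+k]*[1+n]C[1+k]≡[1+n]*nCk zero    (suc k) = begin
    suc (suc k) * (1 C suc (suc k)) ≡⟨ cong (suc (suc k) *_) (k>n⇒nCk≡0 (s≤s (s≤s (z≤n {k})))) ⟩
    suc (suc k) * 0                 ≡⟨ *-zeroʳ (suc (suc k)) ⟩
    0                               ≡⟨ cong (1 *_) (k>n⇒nCk≡0 (s≤s (z≤n {k}))) ⟨
    1 * (0 C suc k)                 ∎
    where open ≡-Reasoning
  [1+k]*[1+n]C[1+k]≡[1+n]*nCk (suc n) zero    = begin
    1 * (suc (suc n) C 1)           ≡⟨ *-identityˡ _ ⟩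
    suc (suc n) C 1                 ≡⟨ nC1≡n (suc (suc n)) ⟩
    suc (suc n)                     ≡⟨ *-identityʳ (suc (suc n)) ⟨
    suc (suc n) * 1                 ≡⟨ cong (suc (suc n) *_) (nC0≡1 (suc n)) ⟨
    suc (suc n) * (suc n C 0)       ∎
    where open ≡-Reasoning
  [1+k]*[1+n]C[1+k]≡[1+n]*nCk (suc n) (suc k) = begin
    suc (suc k) * (suc (suc n) C suc (suc k))    ≡⟨ cong (suc (suc k) *_) (nCk+nC[k+1]≡[n+1]C[k+1] (suc n) (suc k)) ⟨
    suc (suc k) * (X + E)                        ≡⟨ split k X E ⟩
    X + (suc k * X + suc (suc k) * E)            ≡⟨ cong₂ (λ y z → X + (y + z)) ([1+k]*[1+n]C[1+k]≡[1+n]*nCk n k)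
                                                                                ([1+k]*[1+n]C[1+k]≡[1+n]*nCk n (suc k)) ⟩
    X + (suc n * A + suc n * B)                  ≡⟨ cong (λ y → y + (suc n * A + suc n * B)) (nCk+nC[k+1]≡[n+1]C[k+1] n k) ⟨
    (A + B) + (suc n * A + suc n * B)            ≡⟨ merge n A B ⟩
    suc (suc n) * (A + B)                        ≡⟨ cong (suc (suc n) *_) (nCk+nC[k+1]≡[n+1]C[k+1] n k) ⟩
    suc (suc n) * X                              ∎
    where
    open ≡-Reasoning
    A = n C k
    B = n C suc k
    X = suc n C suc k
    E = suc n C suc (suc k)
    split : ∀ k X E → suc (suc k) * (X + E) ≡ X + (suc k * X + suc (suc k) * E)
    split = solve-∀
    merge : ∀ n A B → (A + B) + (suc n * A + suc n * B) ≡ suc (suc n) * (A + B)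
    merge = solve-∀

  prime∣pCk : ∀ {p k} → Prime p → 0 < k → k < p → p ∣ p C k
  prime∣pCk {suc n} {suc k} p-prime _ k<p
    with euclidsLemma (suc k) (suc n C suc k) p-prime
           (divides (n C k) (trans ([1+k]*[1+n]C[1+k]≡[1+n]*nCk n k) (*-comm (suc n) (n C k))))
  ... | inj₁ p∣1+k = ⊥-elim (<⇒≱ k<p (∣⇒≤ p∣1+k))
  ... | inj₂ p∣pCk = p∣pCk

  [1+2h]C2≡[1+2h]*h : ∀ h → (1 + 2 * h) C 2 ≡ (1 + 2 * h) * h
  [1+2h]C2≡[1+2h]*h h = *-cancelˡ-≡ _ _ 2 (begin
    2 * ((1 + 2 * h) C 2)       ≡⟨ [1+k]*[1+n]C[1+k]≡[1+n]*nCk (2 * h) 1 ⟩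
    (1 + 2 * h) * (2 * h C 1)   ≡⟨ cong ((1 + 2 * h) *_) (nC1≡n (2 * h)) ⟩
    (1 + 2 * h) * (2 * h)       ≡⟨ swap h ⟩
    2 * ((1 + 2 * h) * h)       ∎)
    where
    open ≡-Reasoning
    swap : ∀ h → (1 + 2 * h) * (2 * h) ≡ 2 * ((1 + 2 * h) * h)
    swap = solve-∀

  ∑< : ℕ → (ℕ → ℕ) → ℕ
  ∑< zero    f = 0
  ∑< (suc n) f = f 0 + ∑< n (f ∘ suc)

  syntax ∑< n (λ k → e) = ∑[ k < n ] e

  ∑-cong : ∀ n {f g} → (∀ k → f k ≡ g k) → ∑< n f ≡ ∑< n g
  ∑-cong zero    f≗g = refl
  ∑-cong (suc n) f≗g = cong₂ _+_ (f≗g 0) (∑-cong n (f≗g ∘ suc))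

  ∑-distrib-+ : ∀ n f g → ∑[ k < n ] (f k + g k) ≡ ∑< n f + ∑< n g
  ∑-distrib-+ zero    f g = refl
  ∑-distrib-+ (suc n) f g = trans (cong (f 0 + g 0 +_) (∑-distrib-+ n (f ∘ suc) (g ∘ suc)))
                                  (interchange (f 0) (g 0) (∑< n (f ∘ suc)) (∑< n (g ∘ suc)))
    where
    interchange : ∀ a b c d → a + b + (c + d) ≡ a + c + (b + d)
    interchange = solve-∀

  *-distribˡ-∑ : ∀ n c f → c * ∑< n f ≡ ∑[ k < n ] (c * f k)
  *-distribˡ-∑ zero    c f = *-zeroʳ c
  *-distribˡ-∑ (suc n) c f = trans (*-distribˡ-+ c (f 0) _) (cong (c * f 0 +_) (*-distribˡ-∑ n c (f ∘ suc)))

  ∑-last : ∀ n f → ∑< (suc n) f ≡ ∑< n f + f n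
  ∑-last zero    f = +-comm (f 0) 0
  ∑-last (suc n) f = trans (cong (f 0 +_) (∑-last n (f ∘ suc))) (sym (+-assoc (f 0) _ _))

  ∣-∑ : ∀ {d} n f → (∀ k → k < n → d ∣ f k) → d ∣ ∑< n f
  ∣-∑         zero    f d∣f = _ ∣0
  ∣-∑         (suc n) f d∣f = ∣m∣n⇒∣m+n (d∣f 0 (s≤s z≤n)) (∣-∑ n (f ∘ suc) (λ k k<n → d∣f (suc k) (s≤s k<n)))

  binomial : ∀ n x → (x + 1) ^ n ≡ 1 + ∑[ k < n ] ((n C suc k) * x ^ suc k)
  binomial zero    x = refl
  binomial (suc n) x = begin
    (x + 1) * (x + 1) ^ n                             ≡⟨ cong ((x + 1) *_) (binomial n x) ⟩
    (x + 1) * (1 + T)                                 ≡⟨ distribute x T ⟩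
    1 + (x * (1 + T) + T)                             ≡⟨ cong₂ (λ y z → 1 + (x * y + z)) lower upper ⟩
    1 + (x * ∑< (suc n) f + ∑< (suc n) g)             ≡⟨ cong (λ y → 1 + (y + ∑< (suc n) g)) (*-distribˡ-∑ (suc n) x f) ⟩
    1 + (∑[ k < suc n ] (x * f k) + ∑< (suc n) g)     ≡⟨ cong (1 +_) (∑-distrib-+ (suc n) (λ k → x * f k) g) ⟨
    1 + ∑[ k < suc n ] (x * f k + g k)                ≡⟨ cong (1 +_) (∑-cong (suc n) pascal) ⟩
    1 + ∑[ k < suc n ] ((suc n C suc k) * x ^ suc k)  ∎
    where
    open ≡-Reasoning
    f g : ℕ → ℕ
    f k = (n C k) * x ^ k
    g k = (n C suc k) * x ^ suc k
    T = ∑< n g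
    distribute : ∀ x t → (x + 1) * (1 + t) ≡ 1 + (x * (1 + t) + t)
    distribute = solve-∀
    collect : ∀ x a b y → x * (a * y) + b * (x * y) ≡ (a + b) * (x * y)
    collect = solve-∀
    pascal : ∀ k → x * f k + g k ≡ (suc n C suc k) * x ^ suc k
    pascal k = trans (collect x (n C k) (n C suc k) (x ^ k)) (cong (_* x ^ suc k) (nCk+nC[k+1]≡[n+1]C[k+1] n k))
    lower : 1 + T ≡ ∑< (suc n) f
    lower = cong (_+ T) (sym (cong (_* 1) (nC0≡1 n)))
    upper : T ≡ ∑< (suc n) g
    upper = sym (trans (∑-last n g) (trans (cong (λ c → T + c * x ^ suc n) (k>n⇒nCk≡0 (n<1+n n))) (+-identityʳ T)))

  freshmans-dream : ∀ {p} → Prime p → ∀ x → ∃ λ u → (x + 1) ^ p ≡ x ^ p + 1 + u * p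
  freshmans-dream {p@(suc n)} p-prime x
    with ∣-∑ n (λ k → (p C suc k) * x ^ suc k) (λ k k<n → ∣-trans (prime∣pCk p-prime (s≤s z≤n) (s≤s k<n)) (m∣m*n _))
  ... | divides u middle≡up = u , (begin
    (x + 1) ^ p                                                   ≡⟨ binomial p x ⟩
    1 + ∑[ k < p ] ((p C suc k) * x ^ suc k)                      ≡⟨ cong (1 +_) (∑-last n (λ k → (p C suc k) * x ^ suc k)) ⟩
    1 + (∑[ k < n ] ((p C suc k) * x ^ suc k) + (p C p) * x ^ p)  ≡⟨ cong₂ (λ y c → 1 + (y + c * x ^ p)) middle≡up (nCn≡1 p) ⟩
    1 + (u * p + 1 * x ^ p)                                       ≡⟨ rearrange (u * p) (x ^ p) ⟩
    x ^ p + 1 + u * p                                             ∎)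
    where
    open ≡-Reasoning
    rearrange : ∀ a b → 1 + (a + 1 * b) ≡ b + 1 + a
    rearrange = solve-∀

  fermat-ℕ : ∀ {p} → Prime p → ∀ x → ∃ λ t → x ^ p ≡ x + t * p
  fermat-ℕ {suc n} p-prime zero    = 0 , refl
  fermat-ℕ {p}     p-prime (suc x) with freshmans-dream p-prime x | fermat-ℕ p-prime x
  ... | u , [x+1]^p≡ | t , x^p≡ = u + t , (begin
    suc x ^ p              ≡⟨ cong (_^ p) (+-comm 1 x) ⟩
    (x + 1) ^ p            ≡⟨ [x+1]^p≡ ⟩
    x ^ p + 1 + u * p      ≡⟨ cong (λ y → y + 1 + u * p) x^p≡ ⟩
    x + t * p + 1 + u * p  ≡⟨ rearrange x t u p ⟩
    suc x + (u + t) * p    ∎)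
    where
    open ≡-Reasoning
    rearrange : ∀ x t u p → x + t * p + 1 + u * p ≡ suc x + (u + t) * p
    rearrange = solve-∀


module BinomialCongruences where

  open Congruence
  open Residues
  open BinomialCoefficients using (fermat-ℕ)
  open import Data.Empty using (⊥-elim)
  open import Data.Integer using (+_; 0ℤ; 1ℤ; _+_; _-_; _*_; _^_)
  open import Data.Integer.Divisibility.Signed using (_∣_; divides; ∣n⇒∣m*n)
  import Data.Integer.Properties as ℤ
  open import Data.Integer.Tactic.RingSolver using (solve-∀)
  open import Data.Nat as ℕ using (zero; suc)
  open import Data.Nat.Combinatorics using (_C_; nC1≡n; nCk+nC[k+1]≡[n+1]C[k+1])
  import Data.Nat.Divisibility as ℕ
  open import Data.Nat.Primality using (Prime)
  import Data.Nat.Properties as ℕ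
  open import Data.Product using (_,_)
  open import Data.Sum using (inj₁; inj₂)
  open import Relation.Binary.PropositionalEquality using (_≡_; sym; trans; cong; cong₂; module ≡-Reasoning)
  open import Relation.Nullary using (¬_)

  fermat : ∀ {p} → Prime p → ∀ {g} → ¬ p ℕ.∣ g → (+ g) ^ (p ℕ.∸ 1) ≡ 1ℤ [mod + p ]
  fermat {p@(suc q)} p-prime {g} p∤g with euclid-mod p-prime (+ g) ((+ g) ^ q - 1ℤ) g*[g^q-1]≡0
    where
    g*[g^q-1]≡0 : + g * ((+ g) ^ q - 1ℤ) ≡ 0ℤ [mod + p ]
    g*[g^q-1]≡0 with fermat-ℕ p-prime g
    ... | t , g^p≡g+tp = ≡mod (divides (+ t) (begin
      + g * ((+ g) ^ q - 1ℤ) - 0ℤ  ≡⟨ expand (+ g) ((+ g) ^ q) ⟩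
      (+ g) ^ p - + g              ≡⟨ cong (_- + g) (pos-^ g p) ⟨
      + (g ℕ.^ p) - + g            ≡⟨ cong (λ y → + y - + g) g^p≡g+tp ⟩
      + (g ℕ.+ t ℕ.* p) - + g      ≡⟨ cong (_- + g) (pos-+* g t p) ⟩
      + g + + t * + p - + g        ≡⟨ cancel (+ g) (+ t * + p) ⟩
      + t * + p                    ∎))
      where
      open ≡-Reasoning
      expand : ∀ g x → g * (x - 1ℤ) - 0ℤ ≡ g * x - g
      expand = solve-∀
      cancel : ∀ x y → x + y - x ≡ y
      cancel = solve-∀
  ... | inj₁ g≡0       = ⊥-elim (p∤g (≡0-mod⇒∣∣ {x = + g} g≡0))
  ... | inj₂ g^q-1≡0   = -≡0⇒≡mod g^q-1≡0

  [1+t]^i≡1+it+iC2t² : ∀ {t m} → m ∣ t * t * t → ∀ i →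
                       (1ℤ + t) ^ i ≡ 1ℤ + + i * t + + (i C 2) * (t * t) [mod m ]
  [1+t]^i≡1+it+iC2t² {t} m∣t³ zero    = mod-reflexive (vanish t)
    where
    vanish : ∀ t → 1ℤ ≡ 1ℤ + 0ℤ * t + 0ℤ * (t * t)
    vanish = solve-∀
  [1+t]^i≡1+it+iC2t² {t} {m} m∣t³ (suc i) = begin
    (1ℤ + t) * (1ℤ + t) ^ i                                  ≈⟨ *-cong-mod (mod-refl {1ℤ + t}) ([1+t]^i≡1+it+iC2t² m∣t³ i) ⟩
    (1ℤ + t) * (1ℤ + + i * t + + (i C 2) * (t * t))           ≡⟨ expand t (+ i) (+ (i C 2)) ⟩
    1ℤ + (1ℤ + + i) * t + (+ (i C 2) + + i) * (t * t) + + (i C 2) * (t * t * t)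
                                                             ≈⟨ ∣⇒x+y≡x _ (∣n⇒∣m*n (+ (i C 2)) m∣t³) ⟩
    1ℤ + (1ℤ + + i) * t + (+ (i C 2) + + i) * (t * t)         ≡⟨ cong₂ (λ a c → 1ℤ + a * t + c * (t * t)) (sym (ℤ.pos-+ 1 i)) C-step ⟩
    1ℤ + + suc i * t + + (suc i C 2) * (t * t)                ∎
    where
    open ≡-mod-Reasoning m
    expand : ∀ t i c → (1ℤ + t) * (1ℤ + i * t + c * (t * t))
                       ≡ 1ℤ + (1ℤ + i) * t + (c + i) * (t * t) + c * (t * t * t)
    expand = solve-∀
    C-step : + (i C 2) + + i ≡ + (suc i C 2)
    C-step = trans (sym (ℤ.pos-+ (i C 2) i))
               (cong +_ (trans (ℕ.+-comm (i C 2) i)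
                  (trans (cong (ℕ._+ i C 2) (sym (nC1≡n i))) (nCk+nC[k+1]≡[n+1]C[k+1] i 1))))


module PolynomialRoots where

  open PrimeDivisibility using (prime∤1)
  open Congruence
  open Residues
  open import Data.Empty using (⊥-elim)
  open import Data.Integer using (ℤ; +_; 0ℤ; 1ℤ; _+_; _-_; -_; _*_; _^_)
  import Data.Integer.Properties as ℤ
  open import Data.Integer.Tactic.RingSolver using (solve-∀)
  open import Data.List using ([]; _∷_; length; applyUpTo)
  open import Data.List.Properties using (length-applyUpTo)
  open import Data.List.Relation.Unary.All using (All; []; _∷_)
  import Data.List.Relation.Unary.All.Properties as All
  open import Data.List.Relation.Unary.AllPairs using ([]; _∷_)
  open import Data.List.Relation.Unary.Unique.Propositional using (Unique)
  import Data.List.Relation.Unary.Unique.Propositional.Properties as Unique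
  open import Data.Nat as ℕ using (ℕ; zero; suc; _<_; _≤_; z≤n; s≤s; NonZero)
  open import Data.Nat.DivMod using (m<n⇒m%n≡m)
  open import Data.Nat.Primality using (Prime; prime⇒nonZero)
  import Data.Nat.Properties as ℕ
  open import Data.Sum using (inj₁; inj₂)
  open import Function using (_∘_)
  open import Data.Vec using (Vec; []; _∷_; replicate)
  open import Relation.Binary.PropositionalEquality using (_≡_; _≢_; refl; sym; trans; cong; subst)
  open import Relation.Nullary using (¬_)

  -- A vector c₀ ∷ ⋯ ∷ c_{d-1} encodes the monic polynomial X^d + c_{d-1} X^{d-1} + ⋯ + c₀.
  Monic : ℕ → Set
  Monic = Vec ℤ

  eval : ∀ {d} → Monic d → ℤ → ℤ
  eval []       x = 1ℤ
  eval (c ∷ cs) x = x * eval cs x + c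

  divide : ∀ {d} → Monic (suc d) → ℤ → Monic d
  divide (c ∷ [])          r = []
  divide (c ∷ cs@(_ ∷ _)) r = eval cs r ∷ divide cs r

  eval-divide : ∀ {d} (f : Monic (suc d)) r x → eval f x ≡ (x - r) * eval (divide f r) x + eval f r
  eval-divide (c ∷ [])          r x = rearrange x r c
    where
    rearrange : ∀ x r c → x * 1ℤ + c ≡ (x - r) * 1ℤ + (r * 1ℤ + c)
    rearrange = solve-∀
  eval-divide (c ∷ cs@(_ ∷ _)) r x =
    trans (cong (λ y → x * y + c) (eval-divide cs r x)) (rearrange x r (eval (divide cs r) x) (eval cs r) c)
    where
    rearrange : ∀ x r q e c → x * ((x - r) * q + e) + c ≡ (x - r) * (x * q + e) + (r * e + c)
    rearrange = solve-∀

  distinct-residues : ∀ {p x y} .⦃ _ : NonZero p ⦄ → x < p → y < p → x ≢ y → ¬ (+ x ≡ + y [mod + p ])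
  distinct-residues {p} {x} {y} x<p y<p x≢y x≡y =
    x≢y (trans (sym (m<n⇒m%n≡m x<p)) (trans (≡mod⇒%≡% p x y x≡y) (m<n⇒m%n≡m y<p)))

  root-of-divide : ∀ {p} → Prime p → ∀ {d} (f : Monic (suc d)) {r s} → eval f r ≡ 0ℤ [mod + p ] →
                   eval f s ≡ 0ℤ [mod + p ] → ¬ (s ≡ r [mod + p ]) → eval (divide f r) s ≡ 0ℤ [mod + p ]
  root-of-divide {p} p-prime f {r} {s} fr≡0 fs≡0 s≢r with euclid-mod p-prime (s - r) (eval (divide f r) s) [s-r]q≡0
    where
    cancel : ∀ a b → a + b - b ≡ a
    cancel = solve-∀
    [s-r]q≡0 : (s - r) * eval (divide f r) s ≡ 0ℤ [mod + p ]
    [s-r]q≡0 = subst (_≡ 0ℤ [mod + p ]) (trans (cong (_- eval f r) (eval-divide f r s)) (cancel _ _))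
                 (≡mod⇒-≡0 (mod-trans fs≡0 (mod-sym fr≡0)))
  ... | inj₁ s-r≡0 = ⊥-elim (s≢r (-≡0⇒≡mod s-r≡0))
  ... | inj₂ q≡0   = q≡0

  roots-bound : ∀ {p} → Prime p → ∀ {d} (f : Monic d) xs → Unique xs → All (_< p) xs →
                All (λ x → eval f (+ x) ≡ 0ℤ [mod + p ]) xs → length xs ≤ d
  roots-bound p-prime f       []       _ _ _ = z≤n
  roots-bound p-prime []      (x ∷ xs) _ _ (1≡0 ∷ _) = ⊥-elim (prime∤1 p-prime (≡0-mod⇒∣∣ 1≡0))
  roots-bound {p} p-prime f@(_ ∷ _) (x ∷ xs) (x∉xs ∷ xs-unique) (x<p ∷ xs<p) (fx≡0 ∷ fxs≡0) =
    s≤s (roots-bound p-prime (divide f (+ x)) xs xs-unique xs<p (roots-of-divide xs x∉xs xs<p fxs≡0))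
    where
    instance _ = prime⇒nonZero p-prime
    roots-of-divide : ∀ ys → All (x ≢_) ys → All (_< p) ys → All (λ y → eval f (+ y) ≡ 0ℤ [mod + p ]) ys →
                      All (λ y → eval (divide f (+ x)) (+ y) ≡ 0ℤ [mod + p ]) ys
    roots-of-divide []       []            []            []            = []
    roots-of-divide (y ∷ ys) (x≢y ∷ x≢ys) (y<p ∷ ys<p) (fy≡0 ∷ fys≡0) =
      root-of-divide p-prime f fx≡0 fy≡0 (distinct-residues y<p x<p (x≢y ∘ sym)) ∷ roots-of-divide ys x≢ys ys<p fys≡0

  X^[1+e]-1 : ∀ e → Monic (suc e)
  X^[1+e]-1 e = - 1ℤ ∷ replicate e 0ℤ

  eval-X^[1+e]-1 : ∀ e x → eval (X^[1+e]-1 e) x ≡ x ^ suc e - 1ℤ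
  eval-X^[1+e]-1 e x = cong (λ y → x * y - 1ℤ) (eval-X^e e)
    where
    eval-X^e : ∀ e → eval (replicate e 0ℤ) x ≡ x ^ e
    eval-X^e zero    = refl
    eval-X^e (suc e) = trans (ℤ.+-identityʳ _) (cong (x *_) (eval-X^e e))

  all-units-^e≡1⇒p∸1≤e : ∀ {p e} → Prime p → 0 < e →
                         (∀ x → 0 < x → x < p → (+ x) ^ e ≡ 1ℤ [mod + p ]) → p ℕ.∸ 1 ≤ e
  all-units-^e≡1⇒p∸1≤e {p@(suc p-1)} {suc e} p-prime _ x^e≡1 =
    subst (_≤ suc e) (length-applyUpTo suc p-1)
      (roots-bound p-prime (X^[1+e]-1 e) (applyUpTo suc p-1)
        (Unique.applyUpTo⁺₁ suc p-1 (λ i<j _ → ℕ.<⇒≢ (s≤s i<j)))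
        (All.applyUpTo⁺₁ suc p-1 s≤s)
        (All.applyUpTo⁺₁ suc p-1 λ {i} i<p-1 →
          subst (_≡ 0ℤ [mod + p ]) (sym (eval-X^[1+e]-1 e (+ suc i)))
                (≡mod⇒-≡0 (x^e≡1 (suc i) (s≤s z≤n) (s≤s i<p-1)))))


module ChineseRemainder where

  open Congruence
  open Residues
  open PrimeDivisibility using (coprime⇒*∣)
  open import Data.Integer using (ℤ; +_; 0ℤ; 1ℤ; _+_; _-_; -_; _*_)
  open import Data.Integer.Divisibility.Signed using (divides)
  import Data.Integer.Properties as ℤ
  open import Data.Integer.Tactic.RingSolver using (solve-∀)
  import Data.Nat as ℕ
  open import Data.Nat.Coprimality using (Coprime; coprime-Bézout)
  open import Data.Nat.GCD using (module Bézout)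
  open import Data.Product using (∃; ∃₂; _×_; _,_)
  open import Relation.Binary.PropositionalEquality using (_≡_; sym; trans; cong)

  pos-1+vm≡ua : ∀ v m u a → 1 ℕ.+ v ℕ.* m ≡ u ℕ.* a → 1ℤ + + v * + m ≡ + u * + a
  pos-1+vm≡ua v m u a eq = trans (sym (pos-+* 1 v m)) (trans (cong +_ eq) (ℤ.pos-* u a))

  coprime⇒ℤ-Bézout : ∀ {a m} → Coprime a m → ∃₂ λ s t → s * + a + t * + m ≡ 1ℤ
  coprime⇒ℤ-Bézout {a} {m} coprime with coprime-Bézout coprime
  ... | Bézout.+- u v 1+vm≡ua =
    + u , - + v , trans (cong (λ z → z + - + v * + m) (sym (pos-1+vm≡ua v m u a 1+vm≡ua))) (cancel (+ v) (+ m))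
    where
    cancel : ∀ v m → 1ℤ + v * m + - v * m ≡ 1ℤ
    cancel = solve-∀
  ... | Bézout.-+ u v 1+ua≡vm =
    - + u , + v , trans (cong (λ z → - + u * + a + z) (sym (pos-1+vm≡ua u a v m 1+ua≡vm))) (cancel (+ u) (+ a))
    where
    cancel : ∀ u a → - u * a + (1ℤ + u * a) ≡ 1ℤ
    cancel = solve-∀

  chinese-remainder : ∀ {a m} → Coprime a m → ∀ u v → ∃ λ g → g ≡ u [mod + a ] × g ≡ v [mod + m ]
  chinese-remainder {a} {m} coprime u v with coprime⇒ℤ-Bézout coprime
  ... | s , t , sa+tm≡1 = u * (t * + m) + v * (s * + a) , g≡u , g≡v
    where
    km≡0 : ∀ k n → k * n ≡ 0ℤ [mod n ]
    km≡0 k n = ≡mod (divides k (ℤ.+-identityʳ (k * n)))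
    y≡1 : ∀ {y n} k → k * n + y ≡ 1ℤ → y ≡ 1ℤ [mod n ]
    y≡1 {y} {n} k kn+y≡1 = mod-trans (mod-sym (x+km≡x y k n)) (mod-reflexive (trans (ℤ.+-comm y (k * n)) kn+y≡1))
    g≡u : u * (t * + m) + v * (s * + a) ≡ u [mod + a ]
    g≡u = begin
      u * (t * + m) + v * (s * + a)  ≈⟨ +-cong-mod (*-cong-mod (mod-refl {u}) (y≡1 s sa+tm≡1))
                                                   (*-cong-mod (mod-refl {v}) (km≡0 s (+ a))) ⟩
      u * 1ℤ + v * 0ℤ                ≡⟨ collapse u v ⟩
      u                              ∎
      where
      open ≡-mod-Reasoning (+ a)
      collapse : ∀ u v → u * 1ℤ + v * 0ℤ ≡ u
      collapse = solve-∀
    g≡v : u * (t * + m) + v * (s * + a) ≡ v [mod + m ]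
    g≡v = begin
      u * (t * + m) + v * (s * + a)  ≈⟨ +-cong-mod (*-cong-mod (mod-refl {u}) (km≡0 t (+ m)))
                                                   (*-cong-mod (mod-refl {v}) (y≡1 t (trans (ℤ.+-comm (t * + m) (s * + a)) sa+tm≡1))) ⟩
      u * 0ℤ + v * 1ℤ                ≡⟨ collapse u v ⟩
      v                              ∎
      where
      open ≡-mod-Reasoning (+ m)
      collapse : ∀ u v → u * 0ℤ + v * 1ℤ ≡ v
      collapse = solve-∀

  coprime-mod-combine : ∀ {a m x y} → Coprime a m → x ≡ y [mod + a ] → x ≡ y [mod + m ] → x ≡ y [mod + (a ℕ.* m) ]
  coprime-mod-combine {x = x} {y} coprime x≡y[a] x≡y[m] =
    -≡0⇒≡mod (∣∣⇒≡0-mod (coprime⇒*∣ coprime (≡0-mod⇒∣∣ {x = x - y} (≡mod⇒-≡0 x≡y[a]))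
                                           (≡0-mod⇒∣∣ {x = x - y} (≡mod⇒-≡0 x≡y[m]))))

module UnitGroup where

  open Congruence
  open Residues
  open import Data.Integer using (+_; 1ℤ; _-_; _^_; _%ℕ_; _/ℕ_)
  open import Data.Integer.DivMod using (a≡a%ℕn+[a/ℕn]*n; n%ℕd<d)
  open import Data.Integer.Divisibility.Signed using (_∣_; ∣⇒∣ᵤ; ∣ᵤ⇒∣; ∣m∣n⇒∣m-n; ∣m⇒∣m*n)
  open import Data.Integer.Tactic.RingSolver using (solve-∀)
  open import Data.Nat as ℕ using (ℕ; suc; NonZero)
  open import Data.Nat.Coprimality using (Coprime)
  import Data.Nat.Divisibility as ℕ
  open import Data.Nat.Primality using (Prime; prime⇒nonZero)
  import Data.Nat.Properties as ℕ
  open import Data.Product using (_,_)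
  open import Relation.Binary.PropositionalEquality using (_≡_; sym; subst)

  PowIsOne⇒≡mod : ∀ n .⦃ _ : NonZero n ⦄ g k → PowIsOne n g k → (+ g) ^ k ≡ 1ℤ [mod + n ]
  PowIsOne⇒≡mod n g k g^k≡1 = subst (_≡ 1ℤ [mod + n ]) (pos-^ g k) (%≡%⇒≡mod n (g ℕ.^ k) 1 g^k≡1)

  ≡mod⇒PowIsOne : ∀ n .⦃ _ : NonZero n ⦄ g k → (+ g) ^ k ≡ 1ℤ [mod + n ] → PowIsOne n g k
  ≡mod⇒PowIsOne n g k g^k≡1 = ≡mod⇒%≡% n (g ℕ.^ k) 1 (subst (_≡ 1ℤ [mod + n ]) (sym (pos-^ g k)) g^k≡1)

  ^suc≡1⇒coprime : ∀ {n} g e → (+ g) ^ suc e ≡ 1ℤ [mod + n ] → Coprime g n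
  ^suc≡1⇒coprime {n} g e (≡mod n∣g^[1+e]-1) {i} (i∣g , i∣n) =
    ℕ.∣1⇒≡1 (∣⇒∣ᵤ (subst (+ i ∣_) (cancel ((+ g) ^ suc e))
      (∣m∣n⇒∣m-n (∣m⇒∣m*n {+ i} {+ g} ((+ g) ^ e) (∣ᵤ⇒∣ i∣g)) (∣-trans (∣ᵤ⇒∣ i∣n) n∣g^[1+e]-1))))
    where
    open Data.Integer.Divisibility.Signed using (∣-trans)
    cancel : ∀ x → x - (x - 1ℤ) ≡ 1ℤ
    cancel = solve-∀

  -- Reducing x modulo n gives a unit whose order divides q², hence lies in the Sylow q-subgroup.
  ^q²≡1⇒^q≡1 : ∀ {n} .⦃ _ : NonZero n ⦄ → UnitsMaximallyNonCyclic n → ∀ {q} → Prime q →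
               ∀ x → x ^ (q ℕ.^ 2) ≡ 1ℤ [mod + n ] → x ^ q ≡ 1ℤ [mod + n ]
  ^q²≡1⇒^q≡1 {n} max-non-cyclic {q} q-prime x x^q²≡1 =
    mod-trans (^-cong-mod q x≡g) (PowIsOne⇒≡mod n g q (max-non-cyclic q q-prime g (g-unit , 2 , g^q²≡1)))
    where
    g : ℕ
    g = x %ℕ n
    x≡g : x ≡ + g [mod + n ]
    x≡g = mod-trans (mod-reflexive (a≡a%ℕn+[a/ℕn]*n x n)) (x+km≡x (+ g) (x /ℕ n) (+ n))
    g^q²≡1′ : (+ g) ^ (q ℕ.^ 2) ≡ 1ℤ [mod + n ]
    g^q²≡1′ = mod-trans (^-cong-mod (q ℕ.^ 2) (mod-sym x≡g)) x^q²≡1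
    g^q²≡1 : PowIsOne n g (q ℕ.^ 2)
    g^q²≡1 = ≡mod⇒PowIsOne n g (q ℕ.^ 2) g^q²≡1′
    g-unit : IsUnitMod n g
    g-unit = n%ℕd<d x n , ^suc≡1⇒coprime g (ℕ.pred (q ℕ.^ 2))
               (subst (λ k → (+ g) ^ k ≡ 1ℤ [mod + n ]) (sym (ℕ.suc-pred (q ℕ.^ 2) ⦃ q²≢0 ⦄)) g^q²≡1′)
      where
      q²≢0 = ℕ.m^n≢0 q 2 ⦃ prime⇒nonZero q-prime ⦄

module Necessity where

  open PrimeDivisibility
  open Congruence
  open Residues
  open PowersModulo
  open Lifting
  open BinomialCoefficients using ([1+2h]C2≡[1+2h]*h)
  open BinomialCongruences
  open PolynomialRoots using (all-units-^e≡1⇒p∸1≤e)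
  open ChineseRemainder
  open UnitGroup
  open import Data.Empty using (⊥-elim)
  open import Data.Integer using (+_; 1ℤ; _+_; _*_; _^_)
  open import Data.Integer.Divisibility.Signed using (divides; ∣ᵤ⇒∣)
  import Data.Integer.Properties as ℤ
  open import Data.Integer.Tactic.RingSolver using (solve-∀)
  open import Data.Nat as ℕ using (zero; suc; _<_; z≤n; s≤s; NonZero)
  open import Data.Nat.Combinatorics using (_C_)
  import Data.Nat.Divisibility as ℕ
  open import Data.Nat.Primality using (Prime; prime[2]; prime⇒nonZero)
  import Data.Nat.Properties as ℕ
  import Data.Nat.Tactic.RingSolver as ℕ-Solver
  open import Data.Product using (∃; _×_; _,_)
  open import Relation.Binary.PropositionalEquality using (_≡_; _≢_; refl; sym; trans; cong; subst; subst₂)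
  open import Relation.Nullary using (¬_)

  order-q²-witness⇒¬max-non-cyclic : ∀ {n} .⦃ _ : NonZero n ⦄ {q} → Prime q → ∀ x {a} →
    x ^ (q ℕ.^ 2) ≡ 1ℤ [mod + n ] → x ^ q ≡ 1ℤ + + a [mod + n ] → 0 < a → a < n → ¬ UnitsMaximallyNonCyclic n
  order-q²-witness⇒¬max-non-cyclic q-prime x x^q²≡1 x^q≡1+a 0<a a<n max-non-cyclic =
    1+a≢1-mod 0<a a<n (mod-trans (mod-sym x^q≡1+a) (^q²≡1⇒^q≡1 max-non-cyclic q-prime x x^q²≡1))

  max-non-cyclic⇒2^4∤n : ∀ {n} .⦃ _ : NonZero n ⦄ → UnitsMaximallyNonCyclic n → ¬ 2 ℕ.^ 4 ℕ.∣ n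
  max-non-cyclic⇒2^4∤n {n} max-non-cyclic (ℕ.divides k n≡16k) =
    order-q²-witness⇒¬max-non-cyclic prime[2] x x^4≡1 x^2≡1+8k 0<8k 8k<n max-non-cyclic
    where
    K = + k
    x = 1ℤ + K * + 2 * + 2
    n≡ : + n ≡ K * + 16
    n≡ = trans (cong +_ n≡16k) (ℤ.pos-* k 16)
    x^4≡1 : x ^ 4 ≡ 1ℤ [mod + n ]
    x^4≡1 = subst-modulus (trans (sixteen K) (sym n≡)) (^p^j-lift (K * + 2) 2 2 (x+m≡x 1ℤ _))
      where
      sixteen : ∀ k → k * + 2 * (+ 2 * (+ 2 * (+ 2 * 1ℤ))) ≡ k * + 16
      sixteen = solve-∀
    x^2≡1+8k : x ^ 2 ≡ 1ℤ + + (k ℕ.* 8) [mod + n ]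
    x^2≡1+8k = begin
      x ^ 2                         ≡⟨ square K ⟩
      1ℤ + K * + 8 + K * (K * + 16)  ≈⟨ subst-modulus (sym n≡) (x+km≡x (1ℤ + K * + 8) K (K * + 16)) ⟩
      1ℤ + K * + 8                  ≡⟨ cong (_+_ 1ℤ) (ℤ.pos-* k 8) ⟨
      1ℤ + + (k ℕ.* 8)              ∎
      where
      open ≡-mod-Reasoning (+ n)
      square : ∀ k → (1ℤ + k * + 2 * + 2) * ((1ℤ + k * + 2 * + 2) * 1ℤ) ≡ 1ℤ + k * + 8 + k * (k * + 16)
      square = solve-∀
    k≢0 : NonZero k
    k≢0 = nonZero-factor k 16 n≡16k
    0<8k : 0 < k ℕ.* 8
    0<8k = ℕ.>-nonZero⁻¹ (k ℕ.* 8) ⦃ ℕ.m*n≢0 k 8 ⦃ k≢0 ⦄ ⦄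
    8k<n : k ℕ.* 8 < n
    8k<n = subst (k ℕ.* 8 <_) (trans (ℕ.*-assoc k 8 2) (sym n≡16k)) (ℕ.m<m*n (k ℕ.* 8) 2 ⦃ ℕ.m*n≢0 k 8 ⦃ k≢0 ⦄ ⦄ (s≤s (s≤s z≤n)))

  max-non-cyclic⇒p^3∤n : ∀ {n} .⦃ _ : NonZero n ⦄ → UnitsMaximallyNonCyclic n → ∀ p → Prime p → p ≢ 2 → ¬ p ℕ.^ 3 ℕ.∣ n
  max-non-cyclic⇒p^3∤n {n} max-non-cyclic p p-prime p≢2 (ℕ.divides k n≡kp³) with odd-prime p-prime p≢2
  ... | h , p≡1+2h =
    order-q²-witness⇒¬max-non-cyclic p-prime x (subst-modulus (sym n≡) x^p²≡1) (subst-modulus (sym n≡) x^p≡1+a)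
      0<a a<n max-non-cyclic
    where
    K = + k
    P = + p
    t = K * P
    x = 1ℤ + t
    n≡ : + n ≡ K * P ^ 3
    n≡ = trans (cong +_ n≡kp³) (trans (ℤ.pos-* k (p ℕ.^ 3)) (cong (K *_) (pos-^ p 3)))
    x^p²≡1 : x ^ (p ℕ.^ 2) ≡ 1ℤ [mod K * P ^ 3 ]
    x^p²≡1 = ^p^j-lift K p 2 (x+m≡x 1ℤ t)
    pC2≡ph : p C 2 ≡ p ℕ.* h
    pC2≡ph = subst (λ p → p C 2 ≡ p ℕ.* h) (sym p≡1+2h) ([1+2h]C2≡[1+2h]*h h)
    a = p ℕ.* (k ℕ.* p)
    x^p≡1+a : x ^ p ≡ 1ℤ + + a [mod K * P ^ 3 ]
    x^p≡1+a = begin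
      x ^ p                                     ≈⟨ [1+t]^i≡1+it+iC2t² (divides (K * K) (cube K P)) p ⟩
      1ℤ + P * t + + (p C 2) * (t * t)          ≡⟨ cong (λ c → 1ℤ + P * t + c * (t * t)) (trans (cong +_ pC2≡ph) (ℤ.pos-* p h)) ⟩
      1ℤ + P * t + P * + h * (t * t)            ≡⟨ regroup K P (+ h) ⟩
      1ℤ + P * t + + h * K * (K * P ^ 3)        ≈⟨ x+km≡x (1ℤ + P * t) (+ h * K) (K * P ^ 3) ⟩
      1ℤ + P * t                                ≡⟨ cong (_+_ 1ℤ) (trans (ℤ.pos-* p (k ℕ.* p)) (cong (P *_) (ℤ.pos-* k p))) ⟨
      1ℤ + + a                                  ∎
      where
      open ≡-mod-Reasoning (K * P ^ 3)
      cube : ∀ k p → k * p * (k * p) * (k * p) ≡ k * k * (k * (p * (p * (p * 1ℤ))))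
      cube = solve-∀
      regroup : ∀ k p h → 1ℤ + p * (k * p) + p * h * (k * p * (k * p))
                          ≡ 1ℤ + p * (k * p) + h * k * (k * (p * (p * (p * 1ℤ))))
      regroup = solve-∀
    instance
      _ = prime⇒nonZero p-prime
      _ = nonZero-factor k (p ℕ.^ 3) n≡kp³
      _ = ℕ.m*n≢0 k p
    0<a : 0 < a
    0<a = ℕ.>-nonZero⁻¹ a ⦃ ℕ.m*n≢0 p (k ℕ.* p) ⦄
    a<n : a < n
    a<n = subst (a <_) (trans (ap≡kp³ p k) (sym n≡kp³)) (ℕ.m<m*n a p ⦃ ℕ.m*n≢0 p (k ℕ.* p) ⦄ (prime>1 p-prime))
      where
      ap≡kp³ : ∀ p k → p ℕ.* (k ℕ.* p) ℕ.* p ≡ k ℕ.* (p ℕ.* (p ℕ.* (p ℕ.* 1)))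
      ap≡kp³ = ℕ-Solver.solve-∀


  ^q²≡1⇒[^p^a]^q²≡1 : ∀ {p} y q a → y ^ (q ℕ.^ 2) ≡ 1ℤ [mod + p ] → (y ^ (p ℕ.^ a)) ^ (q ℕ.^ 2) ≡ 1ℤ [mod + (p ℕ.^ suc a) ]
  ^q²≡1⇒[^p^a]^q²≡1 {p} y q a y^q²≡1 = subst₂ (λ z M → z ≡ 1ℤ [mod M ])
      (trans (ℤ.^-*-assoc y (q ℕ.^ 2) (p ℕ.^ a))
        (trans (cong (y ^_) (ℕ.*-comm (q ℕ.^ 2) (p ℕ.^ a))) (sym (ℤ.^-*-assoc y (p ℕ.^ a) (q ℕ.^ 2)))))
      (trans (ℤ.*-identityˡ _) (sym (pos-^ p (suc a))))
      (^p^j-lift 1ℤ p a (subst-modulus (sym (ℤ.*-identityˡ (+ p))) y^q²≡1))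

  ^q²≡1⇒[^e]^q≡^q : ∀ {m} y q {e} c → e ≡ 1 ℕ.+ c ℕ.* q → y ^ (q ℕ.^ 2) ≡ 1ℤ [mod m ] → (y ^ e) ^ q ≡ y ^ q [mod m ]
  ^q²≡1⇒[^e]^q≡^q {m} y q c refl y^q²≡1 = begin
    (y ^ (1 ℕ.+ c ℕ.* q)) ^ q         ≡⟨ ℤ.^-*-assoc y (1 ℕ.+ c ℕ.* q) q ⟩
    y ^ ((1 ℕ.+ c ℕ.* q) ℕ.* q)       ≡⟨ cong (y ^_) (exponent c q) ⟩
    y ^ (q ℕ.+ c ℕ.* q ℕ.^ 2)         ≡⟨ ℤ.^-distribˡ-+-* y q (c ℕ.* q ℕ.^ 2) ⟩
    y ^ q * y ^ (c ℕ.* q ℕ.^ 2)       ≈⟨ *-cong-mod (mod-refl {y ^ q}) (^≡1⇒^*≡1 (q ℕ.^ 2) c y^q²≡1) ⟩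
    y ^ q * 1ℤ                        ≡⟨ ℤ.*-identityʳ (y ^ q) ⟩
    y ^ q                             ∎
    where
    open ≡-mod-Reasoning m
    exponent : ∀ c q → (1 ℕ.+ c ℕ.* q) ℕ.* q ≡ q ℕ.+ c ℕ.* (q ℕ.* (q ℕ.* 1))
    exponent = ℕ-Solver.solve-∀

  ^q²≡1⇒^q≡1-mod-prime-factor : ∀ {n} .⦃ _ : NonZero n ⦄ → UnitsMaximallyNonCyclic n →
    ∀ {p q} → Prime p → p ℕ.∣ n → Prime q → q ℕ.∣ p ℕ.∸ 1 →
    ∀ y → y ^ (q ℕ.^ 2) ≡ 1ℤ [mod + p ] → y ^ q ≡ 1ℤ [mod + p ]
  ^q²≡1⇒^q≡1-mod-prime-factor {n} max-non-cyclic {p} {q} p-prime p∣n q-prime q∣p-1 y y^q²≡1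
    with p-part⁺ p-prime p∣n
  ... | a , m , n≡p^[1+a]m , p∤m = finish (chinese-remainder (coprime-^ p-prime p∤m (suc a)) (y ^ (p ℕ.^ a)) 1ℤ)
    where
    finish : (∃ λ g → g ≡ y ^ (p ℕ.^ a) [mod + (p ℕ.^ suc a) ] × g ≡ 1ℤ [mod + m ]) → y ^ q ≡ 1ℤ [mod + p ]
    finish (g , g≡w , g≡1) =
      mod-trans (mod-sym w^q≡y^q) (mod-trans (^-cong-mod q (mod-sym (mod-∣ p∣p^[1+a] g≡w))) g^q≡1)
      where
      w^q≡y^q : (y ^ (p ℕ.^ a)) ^ q ≡ y ^ q [mod + p ]
      w^q≡y^q with ∣[p∸1]⇒p^j≡1+cq ⦃ prime⇒nonZero p-prime ⦄ q∣p-1 a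
      ... | c , p^a≡1+cq = ^q²≡1⇒[^e]^q≡^q y q c p^a≡1+cq y^q²≡1
      p∣p^[1+a] = ∣ᵤ⇒∣ {+ p} {+ (p ℕ.^ suc a)} (ℕ.divides (p ℕ.^ a) (ℕ.*-comm p (p ℕ.^ a)))
      g^q²≡1 : g ^ (q ℕ.^ 2) ≡ 1ℤ [mod + n ]
      g^q²≡1 = subst-modulus (cong +_ (sym n≡p^[1+a]m))
        (coprime-mod-combine (coprime-^ p-prime p∤m (suc a))
          (mod-trans (^-cong-mod (q ℕ.^ 2) g≡w) (^q²≡1⇒[^p^a]^q²≡1 y q a y^q²≡1))
          (mod-trans (^-cong-mod (q ℕ.^ 2) g≡1) (mod-reflexive (ℤ.^-zeroˡ (q ℕ.^ 2)))))
      g^q≡1 : g ^ q ≡ 1ℤ [mod + p ]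
      g^q≡1 = mod-∣ (∣ᵤ⇒∣ {+ p} {+ n} p∣n) (^q²≡1⇒^q≡1 max-non-cyclic q-prime g g^q²≡1)

  max-non-cyclic⇒units^[r*q]≡1 : ∀ {n} .⦃ _ : NonZero n ⦄ → UnitsMaximallyNonCyclic n →
    ∀ {p q r} → Prime p → p ℕ.∣ n → Prime q → p ℕ.∸ 1 ≡ r ℕ.* (q ℕ.* q) →
    ∀ x → 0 < x → x < p → (+ x) ^ (r ℕ.* q) ≡ 1ℤ [mod + p ]
  max-non-cyclic⇒units^[r*q]≡1 max-non-cyclic {p} {q} {r} p-prime p∣n q-prime p-1≡rq² x 0<x x<p =
    subst (_≡ 1ℤ [mod + p ]) (ℤ.^-*-assoc (+ x) r q)
      (^q²≡1⇒^q≡1-mod-prime-factor max-non-cyclic p-prime p∣n q-prime q∣p-1 ((+ x) ^ r)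
        (subst (_≡ 1ℤ [mod + p ]) (sym exponent) (fermat p-prime p∤x)))
    where
    q∣p-1 : q ℕ.∣ p ℕ.∸ 1
    q∣p-1 = ℕ.divides (r ℕ.* q) (trans p-1≡rq² (sym (ℕ.*-assoc r q q)))
    p∤x : ¬ p ℕ.∣ x
    p∤x p∣x = ℕ.<⇒≱ x<p (ℕ.∣⇒≤ ⦃ ℕ.>-nonZero 0<x ⦄ p∣x)
    exponent : ((+ x) ^ r) ^ (q ℕ.^ 2) ≡ (+ x) ^ (p ℕ.∸ 1)
    exponent = trans (ℤ.^-*-assoc (+ x) r (q ℕ.^ 2))
                 (cong ((+ x) ^_) (trans (cong (λ k → r ℕ.* (q ℕ.* k)) (ℕ.*-identityʳ q)) (sym p-1≡rq²)))

  max-non-cyclic⇒p∸1-squarefree : ∀ {n} .⦃ _ : NonZero n ⦄ → UnitsMaximallyNonCyclic n →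
    ∀ p → Prime p → p ℕ.∣ n → SquareFree (p ℕ.∸ 1)
  max-non-cyclic⇒p∸1-squarefree max-non-cyclic p p-prime p∣n zero 0∣p-1 =
    ⊥-elim (ℕ.<⇒≱ (prime>1 p-prime) (ℕ.m∸n≡0⇒m≤n (ℕ.0∣⇒≡0 0∣p-1)))
  max-non-cyclic⇒p∸1-squarefree max-non-cyclic p p-prime p∣n (suc zero) _ = refl
  max-non-cyclic⇒p∸1-squarefree max-non-cyclic p p-prime p∣n d@(suc (suc _)) d²∣p-1
    with prime-factor d (s≤s (s≤s z≤n))
  ... | q , q-prime , q∣d with ℕ.∣-trans (ℕ.*-pres-∣ q∣d q∣d) d²∣p-1
  ...   | ℕ.divides r p-1≡rq² = ⊥-elim (ℕ.<⇒≱ rq<p-1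
          (all-units-^e≡1⇒p∸1≤e p-prime 0<rq (max-non-cyclic⇒units^[r*q]≡1 max-non-cyclic {r = r} p-prime p∣n q-prime p-1≡rq²)))
    where
    instance
      _ = prime⇒nonZero q-prime
      r≢0 : NonZero r
      r≢0 = nonZero-factor r (q ℕ.* q) ⦃ ℕ.>-nonZero (ℕ.m<n⇒0<n∸m (prime>1 p-prime)) ⦄ p-1≡rq²
    0<rq : 0 < r ℕ.* q
    0<rq = ℕ.>-nonZero⁻¹ (r ℕ.* q) ⦃ ℕ.m*n≢0 r q ⦄
    rq<p-1 : r ℕ.* q < p ℕ.∸ 1
    rq<p-1 = subst (r ℕ.* q <_) (trans (ℕ.*-assoc r q q) (sym p-1≡rq²)) (ℕ.m<m*n (r ℕ.* q) q ⦃ ℕ.m*n≢0 r q ⦄ (prime>1 q-prime))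

module Sufficiency where

  open PrimeDivisibility
  open Congruence
  open Residues
  open PowersModulo
  open Lifting
  open BinomialCongruences using (fermat)
  open UnitGroup using (PowIsOne⇒≡mod; ≡mod⇒PowIsOne)
  open import Data.Empty using (⊥-elim)
  open import Data.Integer using (+_; 1ℤ; _-_; _*_; _^_)
  open import Data.Integer.Divisibility.Signed using (divides; ∣ᵤ⇒∣)
  import Data.Integer.Properties as ℤ
  open import Data.Nat as ℕ using (zero; suc; _<_; s≤s; NonZero; _≟_; _%_)
  open import Data.Nat.Coprimality using (coprime-divisor)
  open import Data.Nat.DivMod using (m%n<n)
  import Data.Nat.Divisibility as ℕ
  open import Data.Nat.GCD using (gcd; gcd[m,n]∣m; gcd[m,n]∣n)
  open import Data.Nat.Primality using (Prime; prime⇒irreducible)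
  import Data.Nat.Properties as ℕ
  open import Data.Product using (∃; _×_; _,_)
  open import Data.Sum using (inj₁; inj₂)
  open import Relation.Binary.PropositionalEquality using (_≡_; _≢_; refl; sym; trans; cong; subst)
  open import Relation.Nullary using (¬_; yes; no)

  odd⇒^2≡1-mod-8 : ∀ g → ¬ 2 ℕ.∣ g → (+ g) ^ 2 ≡ 1ℤ [mod + 8 ]
  odd⇒^2≡1-mod-8 g 2∤g =
    mod-trans (^-cong-mod 2 (residue-mod 8 g))
      (odd-residue² (g % 8) (m%n<n g 8) (λ 2∣r → 2∤g (ℕ.∣n∣m%n⇒∣m (ℕ.divides 4 refl) 2∣r)))
    where
    odd-residue² : ∀ r → r < 8 → ¬ 2 ℕ.∣ r → (+ r) ^ 2 ≡ 1ℤ [mod + 8 ]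
    odd-residue² 0 _ 2∤r = ⊥-elim (2∤r (ℕ.divides 0 refl))
    odd-residue² 1 _ _   = mod-refl
    odd-residue² 2 _ 2∤r = ⊥-elim (2∤r (ℕ.divides 1 refl))
    odd-residue² 3 _ _   = ≡mod (divides 1ℤ refl)
    odd-residue² 4 _ 2∤r = ⊥-elim (2∤r (ℕ.divides 2 refl))
    odd-residue² 5 _ _   = ≡mod (divides (+ 3) refl)
    odd-residue² 6 _ 2∤r = ⊥-elim (2∤r (ℕ.divides 3 refl))
    odd-residue² 7 _ _   = ≡mod (divides (+ 6) refl)
    odd-residue² (suc (suc (suc (suc (suc (suc (suc (suc _)))))))) (s≤s (s≤s (s≤s (s≤s (s≤s (s≤s (s≤s (s≤s ())))))))) _

  q²∤2 : ∀ {q} → Prime q → ¬ q ℕ.* q ℕ.∣ 2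
  q²∤2 {q} q-prime q²∣2 =
    ℕ.<⇒≱ (ℕ.≤-trans (ℕ.n≤1+n 3) (ℕ.*-mono-≤ (prime>1 q-prime) (prime>1 q-prime))) (ℕ.∣⇒≤ q²∣2)

  p²∤[p∸1]*p : ∀ {p} → Prime p → ¬ p ℕ.* p ℕ.∣ (p ℕ.∸ 1) ℕ.* p
  p²∤[p∸1]*p {p@(suc (suc r))} _ p²∣[p-1]p = ℕ.1+n≰n (ℕ.∣⇒≤ (ℕ.*-cancelʳ-∣ {p} {suc r} p p²∣[p-1]p))

  q²∤[p∸1]*p : ∀ {p q} → Prime p → Prime q → SquareFree (p ℕ.∸ 1) → ¬ q ℕ.* q ℕ.∣ (p ℕ.∸ 1) ℕ.* p
  q²∤[p∸1]*p {p} {q} p-prime q-prime p-1-squarefree q²∣[p-1]p with q ≟ p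
  ... | yes refl = p²∤[p∸1]*p p-prime q²∣[p-1]p
  ... | no q≢p = prime∤1 q-prime (subst (q ℕ.∣_) (p-1-squarefree q q²∣p-1) ℕ.∣-refl)
    where
    q∤p : ¬ q ℕ.∣ p
    q∤p q∣p with prime⇒irreducible p-prime q∣p
    ... | inj₁ refl = prime∤1 q-prime ℕ.∣-refl
    ... | inj₂ q≡p  = q≢p q≡p
    q²∣p-1 : q ℕ.* q ℕ.∣ p ℕ.∸ 1
    q²∣p-1 = subst (ℕ._∣ p ℕ.∸ 1) (cong (q ℕ.*_) (ℕ.*-identityʳ q))
      (coprime-divisor (coprime-^ q-prime q∤p 2)
        (subst (ℕ._∣ p ℕ.* (p ℕ.∸ 1)) (cong (q ℕ.*_) (sym (ℕ.*-identityʳ q))) (subst (q ℕ.* q ℕ.∣_) (ℕ.*-comm (p ℕ.∸ 1) p) q²∣[p-1]p)))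

  -- gcd (q^k) E divides q because q² ∤ E.
  ^q^k≡1⇒^q≡1 : ∀ {x m q} → Prime q → ∀ k E →
                x ^ (q ℕ.^ k) ≡ 1ℤ [mod m ] → x ^ E ≡ 1ℤ [mod m ] → ¬ q ℕ.* q ℕ.∣ E → x ^ q ≡ 1ℤ [mod m ]
  ^q^k≡1⇒^q≡1 {q = q} q-prime k E x^q^k≡1 x^E≡1 q²∤E =
    ^≡1-∣ (∣p^k∧p²∤⇒∣p q-prime k (gcd[m,n]∣m (q ℕ.^ k) E) (λ q²∣gcd → q²∤E (ℕ.∣-trans q²∣gcd (gcd[m,n]∣n (q ℕ.^ k) E))))
          (^≡1-gcd (q ℕ.^ k) E x^q^k≡1 x^E≡1)

  prime-power-exponent : ∀ {n} → ¬ 2 ℕ.^ 4 ℕ.∣ n → (∀ p → Prime p → p ≢ 2 → ¬ p ℕ.^ 3 ℕ.∣ n) →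
    (∀ p → Prime p → p ℕ.∣ n → SquareFree (p ℕ.∸ 1)) →
    ∀ {p} a → Prime p → p ℕ.^ suc a ℕ.∣ n → ∀ {g} → ¬ p ℕ.∣ g → ∀ {q} → Prime q →
    ∃ λ E → (+ g) ^ E ≡ 1ℤ [mod + (p ℕ.^ suc a) ] × ¬ q ℕ.* q ℕ.∣ E
  prime-power-exponent 2^4∤n p^3∤n squarefree {p} a p-prime p^[1+a]∣n {g} p∤g q-prime with p ≟ 2
  ... | yes refl =
    2 , mod-∣ (∣ᵤ⇒∣ (p^a∣n∧p^[1+b]∤n⇒p^a∣p^b 2 (suc a) 3 p^[1+a]∣n 2^4∤n)) (odd⇒^2≡1-mod-8 g p∤g) , q²∤2 q-prime
  ... | no p≢2 =
    (p ℕ.∸ 1) ℕ.* p ,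
    mod-∣ (∣ᵤ⇒∣ (p^a∣n∧p^[1+b]∤n⇒p^a∣p^b p (suc a) 2 p^[1+a]∣n (p^3∤n p p-prime p≢2))) g^[p-1]p≡1 ,
    q²∤[p∸1]*p p-prime q-prime (squarefree p p-prime (ℕ.∣-trans (ℕ.m∣m*n (p ℕ.^ a)) p^[1+a]∣n))
    where
    g^[p-1]p≡1 : (+ g) ^ ((p ℕ.∸ 1) ℕ.* p) ≡ 1ℤ [mod + (p ℕ.^ 2) ]
    g^[p-1]p≡1 = subst (_≡ 1ℤ [mod + (p ℕ.^ 2) ]) (ℤ.^-*-assoc (+ g) (p ℕ.∸ 1) p)
      (subst-modulus modulus (^p-lift 1ℤ p (subst-modulus (sym (ℤ.*-identityˡ (+ p))) (fermat p-prime p∤g))))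
      where
      modulus : 1ℤ * + p * + p ≡ + (p ℕ.^ 2)
      modulus = trans (cong (_* + p) (ℤ.*-identityˡ (+ p)))
                  (trans (sym (ℤ.pos-* p p)) (cong (λ k → + (p ℕ.* k)) (sym (ℕ.*-identityʳ p))))

  conditions⇒max-non-cyclic : ∀ n .⦃ _ : NonZero n ⦄ → ¬ 2 ℕ.^ 4 ℕ.∣ n → (∀ p → Prime p → p ≢ 2 → ¬ p ℕ.^ 3 ℕ.∣ n) →
    (∀ p → Prime p → p ℕ.∣ n → SquareFree (p ℕ.∸ 1)) → UnitsMaximallyNonCyclic n
  conditions⇒max-non-cyclic n 2^4∤n p^3∤n squarefree q q-prime g ((_ , g-coprime) , k , g^q^k≡1) =
    ≡mod⇒PowIsOne n g q (-≡0⇒≡mod (∣∣⇒≡0-mod (prime-powers∣⇒∣ n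
      (λ p a p-prime p^a∣n → ≡0-mod⇒∣∣ {x = (+ g) ^ q - 1ℤ} (≡mod⇒-≡0 (g^q≡1-mod-prime-power p a p-prime p^a∣n))))))
    where
    g^q≡1-mod-prime-power : ∀ p a → Prime p → p ℕ.^ a ℕ.∣ n → (+ g) ^ q ≡ 1ℤ [mod + (p ℕ.^ a) ]
    g^q≡1-mod-prime-power p zero    _       _        = ≡mod (divides ((+ g) ^ q - 1ℤ) (sym (ℤ.*-identityʳ _)))
    g^q≡1-mod-prime-power p (suc a) p-prime p^[1+a]∣n
      with prime-power-exponent 2^4∤n p^3∤n squarefree a p-prime p^[1+a]∣n p∤g q-prime
      where
      p∤g : ¬ p ℕ.∣ g
      p∤g p∣g = prime∤1 p-prime (subst (p ℕ.∣_) (g-coprime (p∣g , ℕ.∣-trans (ℕ.m∣m*n (p ℕ.^ a)) p^[1+a]∣n)) ℕ.∣-refl)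
    ... | E , g^E≡1 , q²∤E =
      ^q^k≡1⇒^q≡1 q-prime k E (mod-∣ (∣ᵤ⇒∣ p^[1+a]∣n) (PowIsOne⇒≡mod n g (q ℕ.^ k) g^q^k≡1)) g^E≡1 q²∤E

open Necessity
open Sufficiency using (conditions⇒max-non-cyclic)
open import Data.Nat using (ℕ; _^_; _∸_; NonZero)
open import Data.Nat.Divisibility using (_∣_)
open import Data.Nat.Primality using (Prime)
open import Data.Product using (_×_; _,_)
open import Relation.Nullary using (¬_)
open import Relation.Binary.PropositionalEquality using (_≡_)
open import Function.Bundles using (_⇔_; mk⇔)

proposition3p2 : (n : ℕ) → .⦃ _ : NonZero n ⦄ →
    UnitsMaximallyNonCyclic n ⇔
      ((¬ (2 ^ 4 ∣ n))
       × (∀ p → Prime p → ¬ (p ≡ 2) → ¬ (p ^ 3 ∣ n))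
       × (∀ p → Prime p → p ∣ n → SquareFree (p ∸ 1)))
proposition3p2 n = mk⇔
  (λ max-non-cyclic →
     max-non-cyclic⇒2^4∤n max-non-cyclic , max-non-cyclic⇒p^3∤n max-non-cyclic , max-non-cyclic⇒p∸1-squarefree max-non-cyclic)
  (λ (2^4∤n , p^3∤n , p∸1-squarefree) → conditions⇒max-non-cyclic n 2^4∤n p^3∤n p∸1-squarefree)
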